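{- For all integers $m\ge2$ and $n\ge2$, \[ \sum_{k=2}^m c_{mk}\binom{n+k-2}{n}=\frac{n^{m-1}-1}{n-1}. \] Consequently, for each $m\ge2$, the $(m-1)\times(m-1)$ matrix $M_m=\big(\binom{i+k-2}{i}\big)_{2\le i\le m,\ 2\le k\le m}$ (row index $i$, column index $k$) is invertible and \[ \begin{pmatrix}c_{m2}\\ c_{m3}\\ \vdots\\ c_{mm}\end{pmatrix}=M_m^{ -1}\begin{pmatrix}\frac{2^{m-1}-1}{1}\\ \frac{3^{m-1}-1}{2}\\ \vdots\\ \frac{m^{m-1}-1}{m-1}\end{pmatrix}. \]
   Context: For an integer $k\ge 2$, $\psi_k$ is the polynomial in $n$ defined by $\psi_k(n)=n+(k-1)(n-1)\binom{n+k-2}{k-1}=n+\frac{(n-1)n(n+1)\cdots(n+k-2)}{(k-2)!}$. For $m\ge2$, the rational numbers $c_{mk}$, $2\le k\le m$, are the unique coefficients such that $n^m=\sum_{k=2}^m c_{mk}\psi_k(n)$ as polynomials in $n$. -}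

module Defs where

open import Data.Nat as ℕ using (ℕ; zero; suc; _∸_)
open import Data.Nat.Combinatorics using (_C_)
open import Data.Nat using (_!)
open import Data.Integer as ℤ using (ℤ; +_)
open import Data.Rational using (ℚ; _+_; _*_; _-_; _/_; 0ℚ; 1ℚ)
open import Data.Fin using (Fin; toℕ)
open import Data.Fin as Fin using ()
open import Relation.Nullary using (yes; no)
open import Relation.Binary.PropositionalEquality using (_≡_)

toℚ : ℕ → ℚ
toℚ n = (+ n) / 1

_^ℚ_ : ℚ → ℕ → ℚ
x ^ℚ zero = 1ℚ
x ^ℚ suc m = x * (x ^ℚ m)

-- a / d for an integer a and a positive natural d (junk value 0 for d = 0,
-- never used with d = 0 below)
ratio : ℤ → ℕ → ℚ
ratio a zero = 0ℚ
ratio a (suc d) = a / suc d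

Σ : (n : ℕ) → (Fin n → ℚ) → ℚ
Σ zero f = 0ℚ
Σ (suc n) f = f Fin.zero + Σ n (λ i → f (Fin.suc i))

rising : ℚ → ℕ → ℚ
rising x zero = 1ℚ
rising x (suc j) = rising x j * ((x - 1ℚ) + toℚ j)

-- ψ_k(x) = x + (x-1) x (x+1) ... (x+k-2) / (k-2)!   (k factors in the product)
ψ : ℕ → ℚ → ℚ
ψ k x = x + rising x k * ratio (+ 1) ((k ∸ 2) !)

-- index j : Fin (m ∸ 1) stands for k = j + 2 ∈ {2,…,m}
idx : {d : ℕ} → Fin d → ℕ
idx j = toℕ j ℕ.+ 2

-- c : Fin (m ∸ 1) → ℚ are the coefficients c_{mk} (c j = c_{m,j+2}) :
-- x^m = Σ_{k=2}^m c_{mk} ψ_k(x) as polynomials, i.e. for every rational x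
IsCoeff : (m : ℕ) → (Fin (m ∸ 1) → ℚ) → Set
IsCoeff m c = (x : ℚ) → x ^ℚ m ≡ Σ (m ∸ 1) (λ j → c j * ψ (idx j) x)

geom : ℕ → ℕ → ℚ
geom m n = ratio (+ (n ℕ.^ (m ∸ 1)) ℤ.- ℤ.1ℤ) (n ∸ 1)

Mat : ℕ → Set
Mat d = Fin d → Fin d → ℚ

_⊗_ : {d : ℕ} → Mat d → Mat d → Mat d
_⊗_ {d} A B a b = Σ d (λ t → A a t * B t b)

_⊛_ : {d : ℕ} → Mat d → (Fin d → ℚ) → (Fin d → ℚ)
_⊛_ {d} A v a = Σ d (λ t → A a t * v t)

Id : {d : ℕ} → Mat d
Id a b with a Fin.≟ b
... | yes _ = 1ℚ
... | no _ = 0ℚ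

-- M_m with entries binom(i+k-2, i), row i = a+2, column k = b+2
M : (m : ℕ) → Mat (m ∸ 1)
M m a b = toℚ ((idx a ℕ.+ idx b ∸ 2) C idx a)

-- At an integer n ≥ 2 the rising product in ψ_k is a binomial coefficient:
-- ψ_k(n) = n + (n-1) n C(n+k-2, n), while ψ_k(1) = 1.  Evaluating
-- x^m = Σ_k c_{mk} ψ_k(x) at x = 1 gives Σ_k c_{mk} = 1, and at x = n it gives
-- n^m = n + (n-1) n Σ_k c_{mk} C(n+k-2, n), which is the first claim.  Its
-- instances n = 2, …, m say M_m c = g for the vector g of geometric sums.
-- Vandermonde's identity C(i+k-2, i) = Σ_t C(i-2, t) C(k, t+2) factors M_m as
-- a lower times an upper unitriangular Pascal matrix; both are invertible,
-- hence so is M_m, and c = M_m⁻¹ g.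
module Submission where

import Data.Nat.Properties as ℕ
import Algebra.Properties.CommutativeMonoid.Sum ℕ.+-0-commutativeMonoid as ℕ-Sum

module Binomial where
  open import Data.Nat
  open import Data.Nat.Properties
  open import Data.Nat.Combinatorics
  open import Data.Nat.DivMod using (m/n*n≡m)
  open import Data.Nat.Solver using (module +-*-Solver)
  open import Data.Fin using (toℕ)
  open import Relation.Binary.PropositionalEquality
  open +-*-Solver
  open ℕ-Sum using (sum; sum-cong-≗; sum-replicate-zero; ∑-distrib-+)

  m+[n+2]∸2≡m+n : ∀ m n → m + (n + 2) ∸ 2 ≡ m + n
  m+[n+2]∸2≡m+n m n = trans (cong (_∸ 2) (sym (+-assoc m n 2))) (m+n∸n≡m (m + n) 2)

  [a+b]Ca*a!*b!≡[a+b]! : ∀ a b → ((a + b) C a) * (a ! * b !) ≡ (a + b) !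
  [a+b]Ca*a!*b!≡[a+b]! a b = begin
    ((a + b) C a) * (a ! * b !)
      ≡⟨ cong (λ k → ((a + b) C a) * (a ! * k !)) (sym (m+n∸m≡n a b)) ⟩
    ((a + b) C a) * (a ! * (a + b ∸ a) !)
      ≡⟨ cong (_* (a ! * (a + b ∸ a) !)) (nCk≡n!/k![n-k]! a≤a+b) ⟩
    ((a + b) ! / (a ! * (a + b ∸ a) !)) {{a !* (a + b ∸ a) !≢0}} * (a ! * (a + b ∸ a) !)
      ≡⟨ m/n*n≡m {{a !* (a + b ∸ a) !≢0}} (k![n∸k]!∣n! a≤a+b) ⟩
    (a + b) ! ∎
    where
    open ≡-Reasoning
    a≤a+b = m≤m+n a b

  _↑_ : ℕ → ℕ → ℕ
  x ↑ zero = 1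
  x ↑ suc k = x ↑ k * (x + k)

  n!*[1+n]↑k≡[n+k]! : ∀ n k → n ! * (suc n ↑ k) ≡ (n + k) !
  n!*[1+n]↑k≡[n+k]! n zero = trans (*-identityʳ (n !)) (cong _! (sym (+-identityʳ n)))
  n!*[1+n]↑k≡[n+k]! n (suc k) = begin
    n ! * (suc n ↑ k * suc (n + k))  ≡⟨ sym (*-assoc (n !) _ _) ⟩
    n ! * (suc n ↑ k) * suc (n + k)  ≡⟨ cong (_* suc (n + k)) (n!*[1+n]↑k≡[n+k]! n k) ⟩
    (n + k) ! * suc (n + k)          ≡⟨ *-comm ((n + k) !) _ ⟩
    suc (n + k) !                    ≡⟨ cong _! (sym (+-suc n k)) ⟩
    (n + suc k) ! ∎
    where open ≡-Reasoning

  ↑≡!*C : ∀ a j → suc a ↑ (2 + j) ≡ j ! * (suc a * (2 + a) * ((2 + a + j) C (2 + a)))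
  ↑≡!*C a j = *-cancelˡ-≡ _ _ (a !) {{a !≢0}} (begin
    a ! * (suc a ↑ (2 + j))  ≡⟨ n!*[1+n]↑k≡[n+k]! a (2 + j) ⟩
    (a + (2 + j)) !          ≡⟨ cong _! (solve 2 (λ a j → a :+ (con 2 :+ j) := con 2 :+ a :+ j) refl a j) ⟩
    (2 + a + j) !            ≡⟨ sym ([a+b]Ca*a!*b!≡[a+b]! (2 + a) j) ⟩
    B * ((2 + a) ! * j !)    ≡⟨ solve 4 (λ a f g B → B :* ((con 2 :+ a) :* ((con 1 :+ a) :* f) :* g)
                                                  := f :* (g :* ((con 1 :+ a) :* (con 2 :+ a) :* B)))
                                        refl a (a !) (j !) B ⟩
    a ! * (j ! * (suc a * (2 + a) * B)) ∎)
    where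
    open ≡-Reasoning
    B = (2 + a + j) C (2 + a)

  sum-pascal : ∀ a N (g : ℕ → ℕ) →
    sum {suc N} (λ t → (suc a C toℕ t) * g (toℕ t)) ≡
    sum {suc N} (λ t → (a C toℕ t) * g (toℕ t)) + sum {N} (λ t → (a C toℕ t) * g (suc (toℕ t)))
  sum-pascal a N g = begin
    g₀ + sum {N} (λ t → (suc a C suc (toℕ t)) * g (suc (toℕ t)))
      ≡⟨ cong (g₀ +_) (sum-cong-≗ {N} λ t → cong (_* g (suc (toℕ t))) (sym (nCk+nC[k+1]≡[n+1]C[k+1] a (toℕ t)))) ⟩
    g₀ + sum {N} (λ t → (a C toℕ t + a C suc (toℕ t)) * g (suc (toℕ t)))
      ≡⟨ cong (g₀ +_) (trans (sum-cong-≗ {N} λ t → *-distribʳ-+ (g (suc (toℕ t))) (a C toℕ t) _)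
                             (∑-distrib-+ {N} _ _)) ⟩
    g₀ + (sum {N} (λ t → (a C toℕ t) * g (suc (toℕ t))) + sum {N} (λ t → (a C suc (toℕ t)) * g (suc (toℕ t))))
      ≡⟨ solve 3 (λ x y z → x :+ (y :+ z) := (x :+ z) :+ y) refl g₀ _ _ ⟩
    (g₀ + sum {N} (λ t → (a C suc (toℕ t)) * g (suc (toℕ t)))) + sum {N} (λ t → (a C toℕ t) * g (suc (toℕ t))) ∎
    where
    open ≡-Reasoning
    g₀ = 1 * g 0

  vandermonde : ∀ a y s N → a < N → sum {N} (λ t → (a C toℕ t) * (y C (toℕ t + s))) ≡ (a + y) C (a + s)
  vandermonde zero y s (suc N) _ =
    trans (cong₂ _+_ (*-identityˡ (y C s)) (sum-replicate-zero N)) (+-identityʳ (y C s))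
  vandermonde (suc a) y s (suc N) (s≤s a<N) = begin
    sum {suc N} (λ t → (suc a C toℕ t) * (y C (toℕ t + s)))
      ≡⟨ sum-pascal a N (λ t → y C (t + s)) ⟩
    sum {suc N} (λ t → (a C toℕ t) * (y C (toℕ t + s))) + sum {N} (λ t → (a C toℕ t) * (y C (suc (toℕ t) + s)))
      ≡⟨ cong₂ _+_ (vandermonde a y s (suc N) (m≤n⇒m≤1+n a<N))
                   (trans (sum-cong-≗ {N} λ t → cong (λ k → (a C toℕ t) * (y C k)) (sym (+-suc (toℕ t) s)))
                          (vandermonde a y (suc s) N a<N)) ⟩
    (a + y) C (a + s) + (a + y) C (a + suc s)
      ≡⟨ cong (λ k → (a + y) C (a + s) + (a + y) C k) (+-suc a s) ⟩
    (a + y) C (a + s) + (a + y) C suc (a + s)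
      ≡⟨ nCk+nC[k+1]≡[n+1]C[k+1] (a + y) (a + s) ⟩
    (suc a + y) C (suc a + s) ∎
    where open ≡-Reasoning

module Lemmas where
  open Binomial
  open import Defs
  open import Data.Nat as ℕ using (ℕ; zero; suc; _≤_; _∸_; s≤s; z≤n; _!)
  open import Data.Nat.Combinatorics using (_C_; k>n⇒nCk≡0; nCn≡1)
  import Data.Integer as ℤ
  import Data.Integer.Properties as ℤ
  open import Data.Rational using (ℚ; mkℚ; _+_; _*_; _-_; -_; 0ℚ; 1ℚ; toℚᵘ; _/_)
  open import Data.Rational.Properties
    using (normalize-coprime; normalize-pos; toℚᵘ-injective; toℚᵘ-homo-+; toℚᵘ-homo-*; toℚᵘ-fromℚᵘ;
           ≤-antisym; ≤-reflexive; *-cancelˡ-≤-pos; +-inverseˡ; +-inverseʳ; +-identityˡ; +-identityʳ;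
           *-zeroˡ; *-zeroʳ; *-identityˡ; *-identityʳ; *-assoc; *-comm; +-*-commutativeRing; +-0-commutativeMonoid)
  import Data.Rational.Unnormalised as ℚᵘ
  import Data.Rational.Unnormalised.Properties as ℚᵘ
  import Data.Nat.Coprimality as Coprime
  open import Data.Rational.Solver using (module +-*-Solver)
  open import Data.Fin using (Fin; zero; suc; toℕ)
  open import Data.Fin.Properties using (_≟_; toℕ<n)
  open import Data.Product using (_×_; _,_; proj₁; proj₂)
  open import Relation.Nullary using (yes; no)
  open import Relation.Binary.PropositionalEquality
  open import Algebra.Bundles using (CommutativeRing)
  open import Algebra.Properties.CommutativeMonoid.Sum +-0-commutativeMonoid
    using (sum; sum-cong-≗; sum-replicate-zero; ∑-distrib-+; ∑-comm)
  open import Algebra.Properties.Semiring.Sum (CommutativeRing.semiring +-*-commutativeRing)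
    using (*-distribˡ-sum; *-distribʳ-sum)
  open +-*-Solver

  -- toℚ n written in normal form, on which toℚᵘ computes
  toℚ≡mkℚ : ∀ n → toℚ n ≡ mkℚ (ℤ.+ n) 0 (Coprime.sym (Coprime.1-coprimeTo n))
  toℚ≡mkℚ n = normalize-coprime (Coprime.sym (Coprime.1-coprimeTo n))

  toℚ-suc : ∀ n → toℚ (suc n) ≡ 1ℚ + toℚ n
  toℚ-suc n = toℚᵘ-injective (begin
    toℚᵘ (toℚ (suc n))
      ≡⟨ cong toℚᵘ (toℚ≡mkℚ (suc n)) ⟩
    ℚᵘ.mkℚᵘ (ℤ.+ suc n) 0
      ≈⟨ ℚᵘ.*≡* (cong (λ k → (ℤ.1ℤ ℤ.+ k) ℤ.* ℤ.1ℤ) (sym (ℤ.*-identityʳ (ℤ.+ n)))) ⟩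
    toℚᵘ 1ℚ ℚᵘ.+ ℚᵘ.mkℚᵘ (ℤ.+ n) 0
      ≡⟨ cong (λ q → toℚᵘ 1ℚ ℚᵘ.+ toℚᵘ q) (sym (toℚ≡mkℚ n)) ⟩
    toℚᵘ 1ℚ ℚᵘ.+ toℚᵘ (toℚ n)
      ≈⟨ ℚᵘ.≃-sym (toℚᵘ-homo-+ 1ℚ (toℚ n)) ⟩
    toℚᵘ (1ℚ + toℚ n) ∎)
    where open ℚᵘ.≃-Reasoning

  toℚ-+ : ∀ a b → toℚ (a ℕ.+ b) ≡ toℚ a + toℚ b
  toℚ-+ zero b = sym (+-identityˡ (toℚ b))
  toℚ-+ (suc a) b = begin
    toℚ (suc (a ℕ.+ b))    ≡⟨ toℚ-suc (a ℕ.+ b) ⟩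
    1ℚ + toℚ (a ℕ.+ b)     ≡⟨ cong (1ℚ +_) (toℚ-+ a b) ⟩
    1ℚ + (toℚ a + toℚ b)   ≡⟨ solve 2 (λ x y → con 1ℚ :+ (x :+ y) := (con 1ℚ :+ x) :+ y) refl (toℚ a) (toℚ b) ⟩
    (1ℚ + toℚ a) + toℚ b   ≡⟨ cong (_+ toℚ b) (sym (toℚ-suc a)) ⟩
    toℚ (suc a) + toℚ b ∎
    where open ≡-Reasoning

  toℚ-* : ∀ a b → toℚ (a ℕ.* b) ≡ toℚ a * toℚ b
  toℚ-* zero b = sym (*-zeroˡ (toℚ b))
  toℚ-* (suc a) b = begin
    toℚ (b ℕ.+ a ℕ.* b)     ≡⟨ toℚ-+ b (a ℕ.* b) ⟩
    toℚ b + toℚ (a ℕ.* b)   ≡⟨ cong (toℚ b +_) (toℚ-* a b) ⟩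
    toℚ b + toℚ a * toℚ b   ≡⟨ solve 2 (λ x y → y :+ x :* y := (con 1ℚ :+ x) :* y) refl (toℚ a) (toℚ b) ⟩
    (1ℚ + toℚ a) * toℚ b    ≡⟨ cong (_* toℚ b) (sym (toℚ-suc a)) ⟩
    toℚ (suc a) * toℚ b ∎
    where open ≡-Reasoning

  toℚ-^ : ∀ a m → toℚ (a ℕ.^ m) ≡ toℚ a ^ℚ m
  toℚ-^ a zero = refl
  toℚ-^ a (suc m) = trans (toℚ-* a (a ℕ.^ m)) (cong (toℚ a *_) (toℚ-^ a m))

  [n-1]/1≡toℚn-1 : ∀ n → (ℤ.+ n ℤ.- ℤ.1ℤ) / 1 ≡ toℚ n - 1ℚ
  [n-1]/1≡toℚn-1 zero = refl
  [n-1]/1≡toℚn-1 (suc n) = begin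
    toℚ n              ≡⟨ solve 1 (λ x → x := con 1ℚ :+ x :- con 1ℚ) refl (toℚ n) ⟩
    1ℚ + toℚ n - 1ℚ    ≡⟨ cong (_- 1ℚ) (sym (toℚ-suc n)) ⟩
    toℚ (suc n) - 1ℚ ∎
    where open ≡-Reasoning

  *-cancelˡ-toℚ-suc : ∀ n {p q} → toℚ (suc n) * p ≡ toℚ (suc n) * q → p ≡ q
  *-cancelˡ-toℚ-suc n eq = ≤-antisym (*-cancelˡ-≤-pos (toℚ (suc n)) (≤-reflexive eq))
                                      (*-cancelˡ-≤-pos (toℚ (suc n)) (≤-reflexive (sym eq)))
    where instance _ = normalize-pos (suc n) 1

  ratio*toℚ : ∀ i d .{{_ : ℕ.NonZero d}} → ratio i d * toℚ d ≡ i / 1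
  ratio*toℚ i (suc d) = toℚᵘ-injective (begin
    toℚᵘ (i / suc d * toℚ (suc d))                ≈⟨ toℚᵘ-homo-* (i / suc d) (toℚ (suc d)) ⟩
    toℚᵘ (i / suc d) ℚᵘ.* toℚᵘ (toℚ (suc d))      ≈⟨ ℚᵘ.*-cong (toℚᵘ-fromℚᵘ (ℚᵘ.mkℚᵘ i d))
                                                               (ℚᵘ.≃-reflexive (cong toℚᵘ (toℚ≡mkℚ (suc d)))) ⟩
    ℚᵘ.mkℚᵘ i d ℚᵘ.* ℚᵘ.mkℚᵘ (ℤ.+ suc d) 0       ≈⟨ ℚᵘ.*≡* (trans (ℤ.*-identityʳ (i ℤ.* ℤ.+ suc d))
                                                                     (cong (λ k → i ℤ.* ℤ.+ suc k) (sym (ℕ.*-identityʳ d)))) ⟩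
    ℚᵘ.mkℚᵘ i 0                                   ≈⟨ ℚᵘ.≃-sym (toℚᵘ-fromℚᵘ (ℚᵘ.mkℚᵘ i 0)) ⟩
    toℚᵘ (i / 1) ∎)
    where open ℚᵘ.≃-Reasoning

  Σ≡sum : ∀ n (f : Fin n → ℚ) → Σ n f ≡ sum f
  Σ≡sum zero f = refl
  Σ≡sum (suc n) f = cong (f zero +_) (Σ≡sum n (λ i → f (suc i)))

  Σ-cong : ∀ n {f g : Fin n → ℚ} → (∀ i → f i ≡ g i) → Σ n f ≡ Σ n g
  Σ-cong n {f} {g} f≗g rewrite Σ≡sum n f | Σ≡sum n g = sum-cong-≗ f≗g

  Σ-distrib-+ : ∀ n (f g : Fin n → ℚ) → Σ n (λ i → f i + g i) ≡ Σ n f + Σ n g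
  Σ-distrib-+ n f g rewrite Σ≡sum n (λ i → f i + g i) | Σ≡sum n f | Σ≡sum n g = ∑-distrib-+ f g

  *-distribˡ-Σ : ∀ n x (f : Fin n → ℚ) → x * Σ n f ≡ Σ n (λ i → x * f i)
  *-distribˡ-Σ n x f rewrite Σ≡sum n f | Σ≡sum n (λ i → x * f i) = *-distribˡ-sum x f

  *-distribʳ-Σ : ∀ n x (f : Fin n → ℚ) → Σ n f * x ≡ Σ n (λ i → f i * x)
  *-distribʳ-Σ n x f rewrite Σ≡sum n f | Σ≡sum n (λ i → f i * x) = *-distribʳ-sum x f

  Σ-zeroˡ : ∀ n (f : Fin n → ℚ) → Σ n (λ i → 0ℚ * f i) ≡ 0ℚ
  Σ-zeroˡ n f rewrite Σ≡sum n (λ i → 0ℚ * f i) = trans (sum-cong-≗ (λ i → *-zeroˡ (f i))) (sum-replicate-zero n)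

  Σ-comm : ∀ m n (f : Fin m → Fin n → ℚ) → Σ m (λ i → Σ n (f i)) ≡ Σ n (λ j → Σ m (λ i → f i j))
  Σ-comm m n f = begin
    Σ m (λ i → Σ n (f i))          ≡⟨ Σ-cong m (λ i → Σ≡sum n (f i)) ⟩
    Σ m (λ i → sum (f i))          ≡⟨ Σ≡sum m _ ⟩
    sum (λ i → sum (f i))          ≡⟨ ∑-comm f ⟩
    sum (λ j → sum (λ i → f i j))  ≡⟨ sym (Σ≡sum n _) ⟩
    Σ n (λ j → sum (λ i → f i j))  ≡⟨ Σ-cong n (λ j → sym (Σ≡sum m _)) ⟩
    Σ n (λ j → Σ m (λ i → f i j)) ∎
    where open ≡-Reasoning

  Σ-toℚ : ∀ n (f : Fin n → ℕ) → Σ n (λ i → toℚ (f i)) ≡ toℚ (ℕ-Sum.sum f)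
  Σ-toℚ zero f = refl
  Σ-toℚ (suc n) f = trans (cong (toℚ (f zero) +_) (Σ-toℚ n (λ i → f (suc i)))) (sym (toℚ-+ (f zero) _))

  infix 4 _≈ₘ_
  _≈ₘ_ : ∀ {d} → Mat d → Mat d → Set
  A ≈ₘ B = ∀ a b → A a b ≡ B a b

  infix 25 _ᵀ
  _ᵀ : ∀ {d} → Mat d → Mat d
  (A ᵀ) a b = A b a

  Inverse : ∀ {d} → Mat d → Mat d → Set
  Inverse A N = A ⊗ N ≈ₘ Id × N ⊗ A ≈ₘ Id

  Id-suc : ∀ {d} (a b : Fin d) → Id (suc a) (suc b) ≡ Id a b
  Id-suc a b with a ≟ b
  ... | yes _ = refl
  ... | no _ = refl

  Id-sym : ∀ {d} → Id {d} ᵀ ≈ₘ Id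
  Id-sym zero zero = refl
  Id-sym zero (suc b) = refl
  Id-sym (suc a) zero = refl
  Id-sym (suc a) (suc b) = trans (Id-suc b a) (trans (Id-sym a b) (sym (Id-suc a b)))

  Id-⊛ : ∀ {d} (v : Fin d → ℚ) a → (Id ⊛ v) a ≡ v a
  Id-⊛ {suc d} v zero = begin
    1ℚ * v zero + Σ d (λ t → 0ℚ * v (suc t))  ≡⟨ cong (1ℚ * v zero +_) (Σ-zeroˡ d (λ t → v (suc t))) ⟩
    1ℚ * v zero + 0ℚ                          ≡⟨ trans (+-identityʳ _) (*-identityˡ (v zero)) ⟩
    v zero ∎
    where open ≡-Reasoning
  Id-⊛ {suc d} v (suc a) = begin
    0ℚ * v zero + Σ d (λ t → Id (suc a) (suc t) * v (suc t))
      ≡⟨ cong (0ℚ * v zero +_) (Σ-cong d λ t → cong (_* v (suc t)) (Id-suc a t)) ⟩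
    0ℚ * v zero + (Id ⊛ (λ t → v (suc t))) a
      ≡⟨ cong (0ℚ * v zero +_) (Id-⊛ (λ t → v (suc t)) a) ⟩
    0ℚ * v zero + v (suc a)
      ≡⟨ trans (cong (_+ v (suc a)) (*-zeroˡ (v zero))) (+-identityˡ (v (suc a))) ⟩
    v (suc a) ∎
    where open ≡-Reasoning

  ⊛-assoc : ∀ {d} (A B : Mat d) (v : Fin d → ℚ) a → (A ⊛ (B ⊛ v)) a ≡ ((A ⊗ B) ⊛ v) a
  ⊛-assoc {d} A B v a = begin
    Σ d (λ s → A a s * Σ d (λ t → B s t * v t))    ≡⟨ Σ-cong d (λ s → *-distribˡ-Σ d (A a s) _) ⟩
    Σ d (λ s → Σ d (λ t → A a s * (B s t * v t)))  ≡⟨ Σ-comm d d _ ⟩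
    Σ d (λ t → Σ d (λ s → A a s * (B s t * v t)))  ≡⟨ Σ-cong d (λ t → Σ-cong d (λ s → sym (*-assoc (A a s) (B s t) (v t)))) ⟩
    Σ d (λ t → Σ d (λ s → A a s * B s t * v t))    ≡⟨ Σ-cong d (λ t → sym (*-distribʳ-Σ d (v t) _)) ⟩
    Σ d (λ t → Σ d (λ s → A a s * B s t) * v t) ∎
    where open ≡-Reasoning

  ⊗-assoc : ∀ {d} (A B C : Mat d) → (A ⊗ B) ⊗ C ≈ₘ A ⊗ (B ⊗ C)
  ⊗-assoc A B C a b = sym (⊛-assoc A B (λ t → C t b) a)

  ⊛-cong : ∀ {d} {A B : Mat d} {v w : Fin d → ℚ} →
    A ≈ₘ B → (∀ t → v t ≡ w t) → ∀ a → (A ⊛ v) a ≡ (B ⊛ w) a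
  ⊛-cong {d} A≈B v≗w a = Σ-cong d (λ t → cong₂ _*_ (A≈B a t) (v≗w t))

  ⊗-congˡ : ∀ {d} {A B : Mat d} (C : Mat d) → A ≈ₘ B → A ⊗ C ≈ₘ B ⊗ C
  ⊗-congˡ C A≈B a b = ⊛-cong A≈B (λ _ → refl) a

  ⊗-congʳ : ∀ {d} {A B : Mat d} (C : Mat d) → A ≈ₘ B → C ⊗ A ≈ₘ C ⊗ B
  ⊗-congʳ C A≈B a b = ⊛-cong {A = C} (λ _ _ → refl) (λ t → A≈B t b) a

  Id-⊗ : ∀ {d} (A : Mat d) → Id ⊗ A ≈ₘ A
  Id-⊗ A a b = Id-⊛ (λ t → A t b) a

  ⊛-neg : ∀ {d} (A : Mat d) (v : Fin d → ℚ) a → (A ⊛ (λ t → - v t)) a ≡ - (A ⊛ v) a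
  ⊛-neg {d} A v a = begin
    Σ d (λ t → A a t * - v t)
      ≡⟨ Σ-cong d (λ t → solve 2 (λ x y → x :* (:- y) := con (- 1ℚ) :* (x :* y)) refl (A a t) (v t)) ⟩
    Σ d (λ t → - 1ℚ * (A a t * v t))  ≡⟨ sym (*-distribˡ-Σ d (- 1ℚ) _) ⟩
    - 1ℚ * (A ⊛ v) a                  ≡⟨ solve 1 (λ x → con (- 1ℚ) :* x := :- x) refl ((A ⊛ v) a) ⟩
    - (A ⊛ v) a ∎
    where open ≡-Reasoning

  ⊗-ᵀ : ∀ {d} (A B : Mat d) → (A ⊗ B) ᵀ ≈ₘ B ᵀ ⊗ A ᵀ
  ⊗-ᵀ {d} A B a b = Σ-cong d (λ t → *-comm (A b t) (B t a))

  Inverse-⊗ : ∀ {d} {A A' B B' : Mat d} → Inverse A A' → Inverse B B' → Inverse (A ⊗ B) (B' ⊗ A')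
  Inverse-⊗ {A = A} {A'} {B} {B'} (AA' , A'A) (BB' , B'B) = cancel A A' B B' AA' BB' , cancel B' B A' A B'B A'A
    where
    cancel : ∀ {d} (X X' Y Y' : Mat d) → X ⊗ X' ≈ₘ Id → Y ⊗ Y' ≈ₘ Id → (X ⊗ Y) ⊗ (Y' ⊗ X') ≈ₘ Id
    cancel X X' Y Y' XX' YY' a b = begin
      ((X ⊗ Y) ⊗ (Y' ⊗ X')) a b  ≡⟨ ⊗-assoc X Y (Y' ⊗ X') a b ⟩
      (X ⊗ (Y ⊗ (Y' ⊗ X'))) a b  ≡⟨ ⊗-congʳ X (λ c e → sym (⊗-assoc Y Y' X' c e)) a b ⟩
      (X ⊗ ((Y ⊗ Y') ⊗ X')) a b  ≡⟨ ⊗-congʳ X (λ c e → trans (⊗-congˡ X' YY' c e) (Id-⊗ X' c e)) a b ⟩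
      (X ⊗ X') a b               ≡⟨ XX' a b ⟩
      Id a b ∎
      where open ≡-Reasoning

  Inverse-respˡ : ∀ {d} {A B N : Mat d} → A ≈ₘ B → Inverse B N → Inverse A N
  Inverse-respˡ {N = N} A≈B (BN , NB) =
    (λ a b → trans (⊗-congˡ N A≈B a b) (BN a b)) ,
    (λ a b → trans (⊗-congʳ N A≈B a b) (NB a b))

  Inverse-ᵀ : ∀ {d} {A N : Mat d} → Inverse A N → Inverse (A ᵀ) (N ᵀ)
  Inverse-ᵀ {A = A} {N} (AN , NA) =
    (λ a b → trans (sym (⊗-ᵀ N A a b)) (trans (NA b a) (Id-sym a b))) ,
    (λ a b → trans (sym (⊗-ᵀ A N a b)) (trans (AN b a) (Id-sym a b)))

  left-inverse-⊛ : ∀ {d} {A N : Mat d} {x y : Fin d → ℚ} →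
    N ⊗ A ≈ₘ Id → (∀ a → (A ⊛ x) a ≡ y a) → ∀ a → x a ≡ (N ⊛ y) a
  left-inverse-⊛ {A = A} {N} {x} {y} NA≈Id Ax≡y a = begin
    x a              ≡⟨ sym (Id-⊛ x a) ⟩
    (Id ⊛ x) a       ≡⟨ ⊛-cong {A = Id} (λ b c → sym (NA≈Id b c)) (λ _ → refl) a ⟩
    ((N ⊗ A) ⊛ x) a  ≡⟨ sym (⊛-assoc N A x a) ⟩
    (N ⊛ (A ⊛ x)) a  ≡⟨ ⊛-cong {A = N} (λ _ _ → refl) Ax≡y a ⟩
    (N ⊛ y) a ∎
    where open ≡-Reasoning

  LowerUnitriangular : ∀ {d} → Mat d → Set
  LowerUnitriangular L = (∀ a b → toℕ a ℕ.< toℕ b → L a b ≡ 0ℚ) × (∀ a → L a a ≡ 1ℚ)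

  minor : ∀ {d} → Mat (suc d) → Mat d
  minor A a b = A (suc a) (suc b)

  lowerBlock : ∀ {d} → (Fin d → ℚ) → Mat d → Mat (suc d)
  lowerBlock v A zero zero = 1ℚ
  lowerBlock v A zero (suc b) = 0ℚ
  lowerBlock v A (suc a) zero = v a
  lowerBlock v A (suc a) (suc b) = A a b

  lowerBlock-cong : ∀ {d} {v w : Fin d → ℚ} {A B : Mat d} →
    (∀ a → v a ≡ w a) → A ≈ₘ B → lowerBlock v A ≈ₘ lowerBlock w B
  lowerBlock-cong v≗w A≈B zero zero = refl
  lowerBlock-cong v≗w A≈B zero (suc b) = refl
  lowerBlock-cong v≗w A≈B (suc a) zero = v≗w a
  lowerBlock-cong v≗w A≈B (suc a) (suc b) = A≈B a b

  lowerBlock-Id : ∀ {d} → lowerBlock (λ _ → 0ℚ) Id ≈ₘ Id {suc d}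
  lowerBlock-Id zero zero = refl
  lowerBlock-Id zero (suc b) = refl
  lowerBlock-Id (suc a) zero = refl
  lowerBlock-Id (suc a) (suc b) = sym (Id-suc a b)

  lowerBlock-⊗ : ∀ {d} (v w : Fin d → ℚ) (A B : Mat d) →
    lowerBlock v A ⊗ lowerBlock w B ≈ₘ lowerBlock (λ a → v a + (A ⊛ w) a) (A ⊗ B)
  lowerBlock-⊗ {d} v w A B zero zero = cong (1ℚ * 1ℚ +_) (Σ-zeroˡ d w)
  lowerBlock-⊗ {d} v w A B zero (suc b) = cong (1ℚ * 0ℚ +_) (Σ-zeroˡ d (λ t → B t b))
  lowerBlock-⊗ v w A B (suc a) zero = cong (_+ (A ⊛ w) a) (*-identityʳ (v a))
  lowerBlock-⊗ v w A B (suc a) (suc b) = trans (cong (_+ (A ⊗ B) a b) (*-zeroʳ (v a))) (+-identityˡ _)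

  LowerUnitriangular-minor : ∀ {d} {L : Mat (suc d)} → LowerUnitriangular L → LowerUnitriangular (minor L)
  LowerUnitriangular-minor (above-zero , diagonal-one) =
    (λ a b a<b → above-zero (suc a) (suc b) (s≤s a<b)) , (λ a → diagonal-one (suc a))

  LowerUnitriangular⇒lowerBlock : ∀ {d} {L : Mat (suc d)} → LowerUnitriangular L →
    L ≈ₘ lowerBlock (λ a → L (suc a) zero) (minor L)
  LowerUnitriangular⇒lowerBlock (above-zero , diagonal-one) zero zero = diagonal-one zero
  LowerUnitriangular⇒lowerBlock (above-zero , diagonal-one) zero (suc b) = above-zero zero (suc b) (s≤s z≤n)
  LowerUnitriangular⇒lowerBlock _ (suc a) zero = refl
  LowerUnitriangular⇒lowerBlock _ (suc a) (suc b) = refl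

  lowerInverse : ∀ {d} → Mat d → Mat d
  lowerInverse {zero} L = L
  lowerInverse {suc d} L = lowerBlock (N' ⊛ (λ t → - L (suc t) zero)) N'
    where N' = lowerInverse (minor L)

  lowerInverse-inverse : ∀ {d} {L : Mat d} → LowerUnitriangular L → Inverse L (lowerInverse L)
  lowerInverse-inverse {zero} _ = (λ ()) , (λ ())
  lowerInverse-inverse {suc d} {L} L-lower = right , left
    where
    v = λ t → L (suc t) zero
    L' = minor L
    N' = lowerInverse L'
    w = N' ⊛ (λ t → - v t)
    L≈block = LowerUnitriangular⇒lowerBlock L-lower
    IH = lowerInverse-inverse (LowerUnitriangular-minor L-lower)
    open ≡-Reasoning
    right : L ⊗ lowerInverse L ≈ₘ Id
    right a b = begin
      (L ⊗ lowerBlock w N') a b                           ≡⟨ ⊗-congˡ (lowerBlock w N') L≈block a b ⟩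
      (lowerBlock v L' ⊗ lowerBlock w N') a b             ≡⟨ lowerBlock-⊗ v w L' N' a b ⟩
      lowerBlock (λ c → v c + (L' ⊛ w) c) (L' ⊗ N') a b  ≡⟨ lowerBlock-cong column (proj₁ IH) a b ⟩
      lowerBlock (λ _ → 0ℚ) Id a b                        ≡⟨ lowerBlock-Id a b ⟩
      Id a b ∎
      where
      column : ∀ c → v c + (L' ⊛ w) c ≡ 0ℚ
      column c = begin
        v c + (L' ⊛ w) c                     ≡⟨ cong (v c +_) (⊛-assoc L' N' _ c) ⟩
        v c + ((L' ⊗ N') ⊛ (λ t → - v t)) c  ≡⟨ cong (v c +_) (⊛-cong (proj₁ IH) (λ _ → refl) c) ⟩
        v c + (Id ⊛ (λ t → - v t)) c         ≡⟨ cong (v c +_) (Id-⊛ _ c) ⟩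
        v c + - v c                          ≡⟨ +-inverseʳ (v c) ⟩
        0ℚ ∎
    left : lowerInverse L ⊗ L ≈ₘ Id
    left a b = begin
      (lowerBlock w N' ⊗ L) a b                           ≡⟨ ⊗-congʳ (lowerBlock w N') L≈block a b ⟩
      (lowerBlock w N' ⊗ lowerBlock v L') a b             ≡⟨ lowerBlock-⊗ w v N' L' a b ⟩
      lowerBlock (λ c → w c + (N' ⊛ v) c) (N' ⊗ L') a b  ≡⟨ lowerBlock-cong column (proj₂ IH) a b ⟩
      lowerBlock (λ _ → 0ℚ) Id a b                        ≡⟨ lowerBlock-Id a b ⟩
      Id a b ∎
      where
      column : ∀ c → w c + (N' ⊛ v) c ≡ 0ℚ
      column c = trans (cong (_+ (N' ⊛ v) c) (⊛-neg N' v c)) (+-inverseˡ ((N' ⊛ v) c))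

  rising-toℚ : ∀ x k → rising (toℚ (suc x)) k ≡ toℚ (x ↑ k)
  rising-toℚ x zero = refl
  rising-toℚ x (suc k) = begin
    rising (toℚ (suc x)) k * ((toℚ (suc x) - 1ℚ) + toℚ k)
      ≡⟨ cong₂ (λ p q → p * ((q - 1ℚ) + toℚ k)) (rising-toℚ x k) (toℚ-suc x) ⟩
    toℚ (x ↑ k) * ((1ℚ + toℚ x - 1ℚ) + toℚ k)
      ≡⟨ cong (toℚ (x ↑ k) *_) (solve 2 (λ p q → (con 1ℚ :+ p :- con 1ℚ) :+ q := p :+ q) refl (toℚ x) (toℚ k)) ⟩
    toℚ (x ↑ k) * (toℚ x + toℚ k)
      ≡⟨ cong (toℚ (x ↑ k) *_) (sym (toℚ-+ x k)) ⟩
    toℚ (x ↑ k) * toℚ (x ℕ.+ k)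
      ≡⟨ sym (toℚ-* (x ↑ k) (x ℕ.+ k)) ⟩
    toℚ (x ↑ k ℕ.* (x ℕ.+ k)) ∎
    where open ≡-Reasoning

  rising-one : ∀ k → rising 1ℚ (suc k) ≡ 0ℚ
  rising-one zero = refl
  rising-one (suc k) = trans (cong (_* (1ℚ - 1ℚ + toℚ (suc k))) (rising-one k)) (*-zeroˡ (1ℚ - 1ℚ + toℚ (suc k)))

  ψ-one : ∀ k → ψ (suc k) 1ℚ ≡ 1ℚ
  ψ-one k = trans (cong (λ q → 1ℚ + q * r) (rising-one k)) (cong (1ℚ +_) (*-zeroˡ r))
    where r = ratio (ℤ.+ 1) ((k ∸ 1) !)

  toℚ-*-ratio : ∀ d X .{{_ : ℕ.NonZero d}} → toℚ (d ℕ.* X) * ratio (ℤ.+ 1) d ≡ toℚ X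
  toℚ-*-ratio d X = begin
    toℚ (d ℕ.* X) * r     ≡⟨ cong (_* r) (toℚ-* d X) ⟩
    toℚ d * toℚ X * r     ≡⟨ solve 3 (λ p q r → p :* q :* r := q :* (r :* p)) refl (toℚ d) (toℚ X) r ⟩
    toℚ X * (r * toℚ d)   ≡⟨ cong (toℚ X *_) (ratio*toℚ (ℤ.+ 1) d) ⟩
    toℚ X * 1ℚ            ≡⟨ *-identityʳ (toℚ X) ⟩
    toℚ X ∎
    where
    open ≡-Reasoning
    r = ratio (ℤ.+ 1) d

  ψ-toℚ : ∀ a j → ψ (j ℕ.+ 2) (toℚ (2 ℕ.+ a)) ≡
    toℚ (2 ℕ.+ a) + toℚ (suc a) * toℚ (2 ℕ.+ a) * toℚ ((2 ℕ.+ a ℕ.+ j) C (2 ℕ.+ a))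
  ψ-toℚ a j = begin
    x + rising x (j ℕ.+ 2) * ratio (ℤ.+ 1) ((j ℕ.+ 2 ∸ 2) !)
      ≡⟨ cong₂ (λ k i → x + rising x k * ratio (ℤ.+ 1) (i !)) (ℕ.+-comm j 2) (ℕ.m+n∸n≡m j 2) ⟩
    x + rising x (2 ℕ.+ j) * ratio (ℤ.+ 1) (j !)
      ≡⟨ cong (λ q → x + q * ratio (ℤ.+ 1) (j !)) (trans (rising-toℚ (suc a) (2 ℕ.+ j)) (cong toℚ (↑≡!*C a j))) ⟩
    x + toℚ (j ! ℕ.* R) * ratio (ℤ.+ 1) (j !)
      ≡⟨ cong (x +_) (toℚ-*-ratio (j !) R {{ℕ._!≢0 j}}) ⟩
    x + toℚ R
      ≡⟨ cong (x +_) (trans (toℚ-* (suc a ℕ.* (2 ℕ.+ a)) B) (cong (_* toℚ B) (toℚ-* (suc a) (2 ℕ.+ a)))) ⟩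
    x + toℚ (suc a) * x * toℚ B ∎
    where
    open ≡-Reasoning
    x = toℚ (2 ℕ.+ a)
    B = (2 ℕ.+ a ℕ.+ j) C (2 ℕ.+ a)
    R = suc a ℕ.* (2 ℕ.+ a) ℕ.* B

  1^ℚm≡1 : ∀ m → 1ℚ ^ℚ m ≡ 1ℚ
  1^ℚm≡1 zero = refl
  1^ℚm≡1 (suc m) = cong (1ℚ *_) (1^ℚm≡1 m)

  IsCoeff⇒Σ≡1 : ∀ m (c : Fin (m ∸ 1) → ℚ) → IsCoeff m c → Σ (m ∸ 1) c ≡ 1ℚ
  IsCoeff⇒Σ≡1 m c isCoeff = begin
    Σ (m ∸ 1) c
      ≡⟨ Σ-cong (m ∸ 1) (λ j → sym (trans (cong (c j *_) (ψ-idx-one j)) (*-identityʳ (c j)))) ⟩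
    Σ (m ∸ 1) (λ j → c j * ψ (idx j) 1ℚ)
      ≡⟨ sym (isCoeff 1ℚ) ⟩
    1ℚ ^ℚ m
      ≡⟨ 1^ℚm≡1 m ⟩
    1ℚ ∎
    where
    open ≡-Reasoning
    ψ-idx-one : ∀ j → ψ (idx j) 1ℚ ≡ 1ℚ
    ψ-idx-one j = trans (cong (λ k → ψ k 1ℚ) (ℕ.+-comm (toℕ j) 2)) (ψ-one (suc (toℕ j)))

  IsCoeff⇒power : ∀ d (c : Fin d → ℚ) → IsCoeff (suc d) c → ∀ a →
    toℚ (2 ℕ.+ a) ^ℚ d ≡ 1ℚ + toℚ (suc a) * Σ d (λ j → c j * toℚ ((2 ℕ.+ a ℕ.+ toℕ j) C (2 ℕ.+ a)))
  IsCoeff⇒power d c isCoeff a = *-cancelˡ-toℚ-suc (suc a) (begin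
    x * x ^ℚ d                                     ≡⟨ isCoeff x ⟩
    Σ d (λ j → c j * ψ (idx j) x)                  ≡⟨ Σ-cong d expand ⟩
    Σ d (λ j → x * c j + n-1 * x * (c j * B j))    ≡⟨ Σ-distrib-+ d _ _ ⟩
    Σ d (λ j → x * c j) + Σ d (λ j → n-1 * x * (c j * B j))
      ≡⟨ cong₂ _+_ (sym (*-distribˡ-Σ d x c)) (sym (*-distribˡ-Σ d (n-1 * x) _)) ⟩
    x * Σ d c + n-1 * x * S                        ≡⟨ cong (λ s → x * s + n-1 * x * S) (IsCoeff⇒Σ≡1 (suc d) c isCoeff) ⟩
    x * 1ℚ + n-1 * x * S
      ≡⟨ solve 3 (λ x n s → x :* con 1ℚ :+ n :* x :* s := x :* (con 1ℚ :+ n :* s)) refl x n-1 S ⟩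
    x * (1ℚ + n-1 * S) ∎)
    where
    open ≡-Reasoning
    x = toℚ (2 ℕ.+ a)
    n-1 = toℚ (suc a)
    B : Fin d → ℚ
    B j = toℚ ((2 ℕ.+ a ℕ.+ toℕ j) C (2 ℕ.+ a))
    S = Σ d (λ j → c j * B j)
    expand : ∀ j → c j * ψ (idx j) x ≡ x * c j + n-1 * x * (c j * B j)
    expand j = begin
      c j * ψ (toℕ j ℕ.+ 2) x      ≡⟨ cong (c j *_) (ψ-toℚ a (toℕ j)) ⟩
      c j * (x + n-1 * x * B j)    ≡⟨ solve 4 (λ c x n b → c :* (x :+ n :* x :* b) := x :* c :+ n :* x :* (c :* b))
                                              refl (c j) x n-1 (B j) ⟩
      x * c j + n-1 * x * (c j * B j) ∎

  geom*toℚ : ∀ d a → geom (suc d) (2 ℕ.+ a) * toℚ (suc a) ≡ toℚ (2 ℕ.+ a) ^ℚ d - 1ℚ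
  geom*toℚ d a = begin
    ratio (ℤ.+ N ℤ.- ℤ.1ℤ) (suc a) * toℚ (suc a)  ≡⟨ ratio*toℚ (ℤ.+ N ℤ.- ℤ.1ℤ) (suc a) ⟩
    (ℤ.+ N ℤ.- ℤ.1ℤ) / 1                          ≡⟨ [n-1]/1≡toℚn-1 N ⟩
    toℚ N - 1ℚ                                    ≡⟨ cong (_- 1ℚ) (toℚ-^ (2 ℕ.+ a) d) ⟩
    toℚ (2 ℕ.+ a) ^ℚ d - 1ℚ ∎
    where
    open ≡-Reasoning
    N = (2 ℕ.+ a) ℕ.^ d

  IsCoeff⇒Σ≡geom : ∀ d (c : Fin d → ℚ) → IsCoeff (suc d) c → ∀ a →
    Σ d (λ j → c j * toℚ ((2 ℕ.+ a ℕ.+ toℕ j) C (2 ℕ.+ a))) ≡ geom (suc d) (2 ℕ.+ a)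
  IsCoeff⇒Σ≡geom d c isCoeff a = *-cancelˡ-toℚ-suc a (begin
    n-1 * S                    ≡⟨ solve 2 (λ n s → n :* s := (con 1ℚ :+ n :* s) :- con 1ℚ) refl n-1 S ⟩
    (1ℚ + n-1 * S) - 1ℚ        ≡⟨ cong (_- 1ℚ) (sym (IsCoeff⇒power d c isCoeff a)) ⟩
    toℚ (2 ℕ.+ a) ^ℚ d - 1ℚ    ≡⟨ sym (geom*toℚ d a) ⟩
    geom (suc d) (2 ℕ.+ a) * n-1  ≡⟨ *-comm _ n-1 ⟩
    n-1 * geom (suc d) (2 ℕ.+ a) ∎)
    where
    open ≡-Reasoning
    n-1 = toℚ (suc a)
    S = Σ d (λ j → c j * toℚ ((2 ℕ.+ a ℕ.+ toℕ j) C (2 ℕ.+ a)))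

  binomial-sum≡geom : (m : ℕ) → 2 ≤ m → (c : Fin (m ∸ 1) → ℚ) → IsCoeff m c →
    (n : ℕ) → 2 ≤ n → Σ (m ∸ 1) (λ j → c j * toℚ ((n ℕ.+ idx j ∸ 2) C n)) ≡ geom m n
  binomial-sum≡geom (suc (suc d)) (s≤s (s≤s z≤n)) c isCoeff (suc (suc a)) (s≤s (s≤s z≤n)) =
    trans (Σ-cong (suc d) (λ j → cong (λ k → c j * toℚ (k C (2 ℕ.+ a))) (m+[n+2]∸2≡m+n (2 ℕ.+ a) (toℕ j))))
          (IsCoeff⇒Σ≡geom (suc d) c isCoeff a)

  pascal : ∀ {d} → ℕ → Mat d
  pascal k a b = toℚ ((toℕ a ℕ.+ k) C (toℕ b ℕ.+ k))

  pascal-lower : ∀ {d} k → LowerUnitriangular (pascal {d} k)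
  pascal-lower k =
    (λ a b a<b → cong toℚ (k>n⇒nCk≡0 (ℕ.+-monoˡ-< k a<b))) , (λ a → cong toℚ (nCn≡1 (toℕ a ℕ.+ k)))

  M≈pascal⊗pascalᵀ : ∀ m → M m ≈ₘ pascal 0 ⊗ pascal 2 ᵀ
  M≈pascal⊗pascalᵀ m a b = sym (begin
    Σ d (λ t → toℚ ((A ℕ.+ 0) C (toℕ t ℕ.+ 0)) * toℚ (U t))
      ≡⟨ Σ-cong d (λ t → trans (cong₂ (λ p q → toℚ (p C q) * toℚ (U t)) (ℕ.+-identityʳ A) (ℕ.+-identityʳ (toℕ t)))
                              (sym (toℚ-* (A C toℕ t) (U t)))) ⟩
    Σ d (λ t → toℚ ((A C toℕ t) ℕ.* U t))
      ≡⟨ Σ-toℚ d _ ⟩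
    toℚ (ℕ-Sum.sum {d} (λ t → (A C toℕ t) ℕ.* U t))
      ≡⟨ cong toℚ (vandermonde A (B ℕ.+ 2) 2 d (toℕ<n a)) ⟩
    toℚ ((A ℕ.+ (B ℕ.+ 2)) C (A ℕ.+ 2))
      ≡⟨ cong (λ k → toℚ (k C (A ℕ.+ 2))) (sym upper-index) ⟩
    toℚ ((idx a ℕ.+ idx b ∸ 2) C idx a) ∎)
    where
    open ≡-Reasoning
    d = m ∸ 1
    A = toℕ a
    B = toℕ b
    U : Fin d → ℕ
    U t = (B ℕ.+ 2) C (toℕ t ℕ.+ 2)
    upper-index : A ℕ.+ 2 ℕ.+ (B ℕ.+ 2) ∸ 2 ≡ A ℕ.+ (B ℕ.+ 2)
    upper-index = trans (m+[n+2]∸2≡m+n (A ℕ.+ 2) B) (trans (ℕ.+-assoc A 2 B) (cong (A ℕ.+_) (ℕ.+-comm 2 B)))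

  M⁻¹ : ∀ m → Mat (m ∸ 1)
  M⁻¹ m = lowerInverse (pascal 2) ᵀ ⊗ lowerInverse (pascal 0)

  M-inverse : ∀ m → Inverse (M m) (M⁻¹ m)
  M-inverse m = Inverse-respˡ {B = pascal 0 ⊗ pascal 2 ᵀ} (M≈pascal⊗pascalᵀ m)
    (Inverse-⊗ {A = pascal 0} {B = pascal 2 ᵀ}
      (lowerInverse-inverse {L = pascal 0} (pascal-lower 0))
      (Inverse-ᵀ {A = pascal 2} (lowerInverse-inverse {L = pascal 2} (pascal-lower 2))))

open import Defs
open import Data.Nat using (ℕ; _≤_; _∸_; _+_)
open import Data.Nat.Combinatorics using (_C_)
open import Data.Rational using (ℚ; _*_)
open import Data.Rational.Properties using (*-comm)
open import Data.Fin using (Fin; toℕ)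
open import Data.Product using (Σ-syntax; _×_; _,_; proj₁; proj₂)
open import Relation.Binary.PropositionalEquality using (_≡_; trans)
open Lemmas using (binomial-sum≡geom; M⁻¹; M-inverse; left-inverse-⊛; Σ-cong)

fact6 : (m : ℕ) → 2 ≤ m → (c : Fin (m ∸ 1) → ℚ) → IsCoeff m c →
            ((n : ℕ) → 2 ≤ n →
              Σ (m ∸ 1) (λ j → c j * toℚ ((n + idx j ∸ 2) C n)) ≡ geom m n)
            × (Σ[ N ∈ Mat (m ∸ 1) ]
                ((a b : Fin (m ∸ 1)) → (M m ⊗ N) a b ≡ Id a b)
                × ((a b : Fin (m ∸ 1)) → (N ⊗ M m) a b ≡ Id a b)
                × ((a : Fin (m ∸ 1)) → c a ≡ (N ⊛ (λ b → geom m (idx b))) a))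
fact6 m 2≤m c isCoeff =
  binomial-sum≡geom m 2≤m c isCoeff , M⁻¹ m , proj₁ (M-inverse m) , proj₂ (M-inverse m) ,
  left-inverse-⊛ {A = M m} {N = M⁻¹ m} (proj₂ (M-inverse m)) M⊛c≡geom
  where
  M⊛c≡geom : ∀ b → (M m ⊛ c) b ≡ geom m (idx b)
  M⊛c≡geom b = trans (Σ-cong (m ∸ 1) (λ t → *-comm (M m b t) (c t)))
                     (binomial-sum≡geom m 2≤m c isCoeff (idx b) (ℕ.m≤n+m 2 (toℕ b)))
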